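{- Let $s\geq r\geq 2$ be integers and let $F$ be a graph. Then, as $n\to\infty$, $\mathrm{ex}_r(n,K_s^{(r)},F^r)=\Theta(n^s)$ if and only if $\chi(F)>s$.
   Context: An $r$-graph is a hypergraph all of whose hyperedges have exactly $r$ vertices. $K_s^{(r)}$ is the complete $r$-graph on $s$ vertices. For a graph $F$, the $r$-expansion $F^r$ is the $r$-graph obtained from $F$ by adding $r-2$ new vertices to each edge of $F$, where all $(r-2)e(F)$ new vertices are distinct from each other and from $V(F)$. For $r$-graphs $\mathcal{H},\mathcal{F}$, $\mathrm{ex}_r(n,\mathcal{H},\mathcal{F})$ is the maximum number of copies of $\mathcal{H}$ in an $n$-vertex $r$-graph containing no copy of $\mathcal{F}$ as a subhypergraph. $\chi(F)$ is the chromatic number of $F$. -}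

module Defs where

open import Data.Nat using (ℕ; zero; suc; _+_; _*_; _∸_; _^_; _≤_; _<_)
open import Data.Bool using (Bool; true; false; T; _∧_; _∨_; not)
open import Data.Fin using (Fin)
import Data.Fin as F
open import Data.Fin.Subset using (Subset; ⁅_⁆; _∪_; ∣_∣)
import Data.Fin.Subset as Sub
open import Data.Vec using (Vec; []; _∷_; toList)
open import Data.List using (List; []; _∷_; map; _++_; filter; length; foldr)
open import Data.Product using (Σ; Σ-syntax; _×_; _,_; ∃; ∃-syntax)
open import Data.Sum using (_⊎_; inj₁; inj₂)
open import Relation.Nullary using (¬_)
open import Relation.Binary.PropositionalEquality using (_≡_)
open import Function.Definitions using (Injective)
import Data.Vec.Functional as VF

record Graph (m : ℕ) : Set where
  field
    adj     : Fin m → Fin m → Bool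
    adj-sym : ∀ u v → adj u v ≡ adj v u
    irrefl  : ∀ u → adj u u ≡ false
open Graph public

ProperColouring : ∀ {m} → Graph m → (k : ℕ) → (Fin m → Fin k) → Set
ProperColouring G k c = ∀ u v → T (adj G u v) → ¬ (c u ≡ c v)

-- χ(G) ≤ k  iff G admits a proper k-colouring (χ is the least such k).
Colourable : ∀ {m} → Graph m → ℕ → Set
Colourable G k = Σ[ c ∈ (Fin _ → Fin k) ] ProperColouring G k c

ChromaticNumberExceeds : ∀ {m} → Graph m → ℕ → Set
ChromaticNumberExceeds G s = ¬ Colourable G s

allSubsets : (n : ℕ) → List (Subset n)
allSubsets zero = [] ∷ []
allSubsets (suc n) = map (true ∷_) (allSubsets n) ++ map (false ∷_) (allSubsets n)

_⊆ᵇ_ : ∀ {n} → Subset n → Subset n → Bool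
[] ⊆ᵇ [] = true
(a ∷ S) ⊆ᵇ (b ∷ T') = (not a ∨ b) ∧ (S ⊆ᵇ T')

_≡ᵇ_ : ℕ → ℕ → Bool
zero ≡ᵇ zero = true
zero ≡ᵇ suc _ = false
suc _ ≡ᵇ zero = false
suc a ≡ᵇ suc b = a ≡ᵇ b

allᵇ : ∀ {A : Set} → (A → Bool) → List A → Bool
allᵇ p = foldr (λ x b → p x ∧ b) true

setOf : ∀ {n} → List (Fin n) → Subset n
setOf = foldr (λ x S → ⁅ x ⁆ ∪ S) Sub.⊥

record RGraph (r n : ℕ) : Set where
  field
    edge    : Subset n → Bool
    uniform : ∀ S → T (edge S) → ∣ S ∣ ≡ r
open RGraph public

spansClique : ∀ {r n} → RGraph r n → Subset n → Bool
spansClique {r} {n} H S =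
  allᵇ (λ U → not ((U ⊆ᵇ S) ∧ (∣ U ∣ ≡ᵇ r)) ∨ edge H U) (allSubsets n)

-- Number of copies of K_s^(r) in H (copies of a complete r-graph
-- correspond exactly to its vertex sets).
numCliques : ∀ {r n} → (s : ℕ) → RGraph r n → ℕ
numCliques {r} {n} s H =
  length (filter (λ S → T? ((∣ S ∣ ≡ᵇ s) ∧ spansClique H S)) (allSubsets n))
  where
    open import Relation.Nullary.Decidable using (Dec)
    open import Data.Bool using (T?)

-- The r-expansion F^r of a graph F on Fin m: vertices are the vertices of
-- F together with r-2 new vertices for each edge {u,v} (u < v) of F.

EdgeOf : ∀ {m} → Graph m → Set
EdgeOf {m} F = Σ[ u ∈ Fin m ] Σ[ v ∈ Fin m ] (T (adj F u v) × u F.< v)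

ExpVertex : ∀ {m} → ℕ → Graph m → Set
ExpVertex {m} r F = Fin m ⊎ (EdgeOf F × Fin (r ∸ 2))

expEdgeImage : ∀ {m n} (r : ℕ) (F : Graph m) → (ExpVertex r F → Fin n) → EdgeOf F → Subset n
expEdgeImage r F ι (u , v , p) =
  setOf (ι (inj₁ u) ∷ ι (inj₁ v) ∷ toList (Data.Vec.tabulate (λ i → ι (inj₂ ((u , v , p) , i)))))
  where import Data.Vec

ContainsExpansion : ∀ {r n m} → RGraph r n → Graph m → Set
ContainsExpansion {r} {n} H F =
  Σ[ ι ∈ (ExpVertex r F → Fin n) ]
    (Injective _≡_ _≡_ ι × (∀ e → T (edge H (expEdgeImage r F ι e))))

-- ex_r(n, K_s^(r), F^r) = Θ(n^s), with "ex ≤ x" unfolded as "every F^r-free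
-- H has at most x copies" and "ex ≥ x" as "some F^r-free H has at least x copies".

ExUpperO : (r s : ℕ) → ∀ {m} → Graph m → Set
ExUpperO r s F =
  ∃[ C ] ∃[ N ] ∀ n → N ≤ n → (H : RGraph r n) → ¬ ContainsExpansion H F →
    numCliques s H ≤ C * n ^ s

ExLowerΩ : (r s : ℕ) → ∀ {m} → Graph m → Set
ExLowerΩ r s F =
  ∃[ k ] ∃[ N ] ∀ n → N ≤ n →
    Σ[ H ∈ RGraph r n ] (¬ ContainsExpansion H F × n ^ s ≤ k * numCliques s H)

ExTheta : (r s : ℕ) → ∀ {m} → Graph m → Set
ExTheta r s F = ExUpperO r s F × ExLowerΩ r s F

-- If χ(F) ≤ s, extend a proper s-colouring of F to F^r so that every hyperedge is rainbow (possible as r ≤ s);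
-- then F^r embeds into any blow-up of K_s^(r) with parts of size |V(F^r)|. An F^r-free r-graph with n^s / k
-- copies of K_s^(r) would contradict Erdős's supersaturation: by iterated power means there are at least
-- n^(st) / k^(t^s) boxes of s rows of t vertices all of whose transversals span cliques, while only
-- O(n^(st-1)) boxes repeat a vertex within a row, so for large n some box is a genuine blow-up.
-- If χ(F) > s, the complete s-partite r-graph with the residue classes mod s as parts is F^r-free, since
-- an embedding would colour F properly by residues, and it has at least (n / 2s)^s copies of K_s^(r);
-- the bound O(n^s) holds for every r-graph.

module Submission where

open import Data.Bool.Base using (Bool; true; false; _∧_; _∨_; not; T)
open import Data.Bool.Properties using (T-∧; T-irrelevant; T?)
open import Data.Empty using (⊥-elim)
open import Data.Fin.Base as Fin using (Fin; zero; suc; toℕ; combine; join; splitAt; punchIn; punchOut; inject≤)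
open import Data.Fin.Properties as Finₚ
  using (_≟_; toℕ-injective; toℕ-fromℕ<; toℕ-combine; toℕ<n; toℕ-inject≤; inject≤-injective; combine-injective;
         splitAt-join; punchIn-injective; punchInᵢ≢i; punchIn-punchOut; <-cmp; <-irrefl; <-irrelevant)
open import Data.Fin.Subset using (Subset; ⁅_⁆; _∪_; ∣_∣)
  renaming (_∈_ to _∈ₛ_; _∉_ to _∉ₛ_; _⊆_ to _⊆ₛ_)
open import Data.Fin.Subset.Properties using (∉⊥; x∈⁅x⁆; x∈⁅y⁆⇒x≡y; x∈p∪q⁻; x∈p∪q⁺; ∪-identityˡ; ∣⊥∣≡0; drop-∷-⊆; ⊆-antisym; _∈?_)
open import Data.List.Base as List using (List; []; _∷_; _++_; map; length; filter; cartesianProductWith; allFin)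
open import Data.List.Properties using (++-identityʳ; length-map; length-tabulate; map-tabulate; length-removeAt′)
open import Data.List.Membership.Propositional using (_∈_; _─_)
open import Data.List.Membership.Propositional.Properties
  using (∈-allFin; ∈-filter⁺; ∈-filter⁻; ∈-map⁺; ∈-map⁻; ∈-tabulate⁺; ∈-tabulate⁻; ∈-cartesianProductWith⁺)
open import Data.List.Relation.Binary.Subset.Propositional using (_⊆_)
open import Data.List.Relation.Unary.All using (All; []; _∷_)
import Data.List.Relation.Unary.All as All
import Data.List.Relation.Unary.All.Properties as All
open import Data.List.Relation.Unary.AllPairs using (AllPairs; []; _∷_)
import Data.List.Relation.Unary.AllPairs as AllPairs
import Data.List.Relation.Unary.AllPairs.Properties as AllPairs
open import Data.List.Relation.Unary.Any using (here; there; index)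
open import Data.List.Relation.Unary.Unique.DecPropositional using (unique?)
open import Data.List.Relation.Unary.Unique.Propositional using (Unique)
import Data.List.Relation.Unary.Unique.Propositional.Properties as Unique
open import Data.Nat.Base using (ℕ; zero; suc; _+_; _*_; _∸_; _^_; _≤_; _<_; z≤n; s≤s; NonZero; >-nonZero)
open import Data.Nat.DivMod using (_/_; _%_; _mod_; m≡m%n+[m/n]*n; m%n<n; m/n*n≤m; m≥n⇒m/n>0; [m+kn]%n≡m%n; m<n⇒m%n≡m)
open import Data.Nat.Properties hiding (_≟_; <-cmp; <-irrefl; <-irrelevant)
open import Data.Nat.Tactic.RingSolver using (solve-∀)
open import Algebra.Properties.CommutativeSemigroup +-commutativeSemigroup using () renaming (interchange to +-interchange)
open import Algebra.Properties.CommutativeSemigroup *-commutativeSemigroup using ()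
  renaming (interchange to *-interchange; x∙yz≈y∙xz to x*[y*z]≡y*[x*z]; x∙yz≈yx∙z to x*[y*z]≡y*x*z;
            x∙yz≈z∙xy to x*[y*z]≡z*[x*y]; xy∙z≈y∙xz to x*y*z≡y*[x*z]; xy∙z≈x∙zy to x*y*z≡x*[z*y])
open import Data.Product.Base using (_×_; _,_; proj₁; proj₂; ∃)
open import Data.Sum.Base as Sum using (_⊎_; inj₁; inj₂; [_,_])
open import Data.Sum.Properties using (inj₁-injective; inj₂-injective)
open import Data.Unit.Base using (tt)
open import Data.Vec.Base as Vec using (Vec; []; _∷_; lookup; tabulate; toList; fromList)
open import Data.Vec.Functional using (Vector; updateAt)
open import Data.Vec.Functional.Properties using (updateAt-updates; updateAt-minimal)
open import Data.Vec.Membership.Propositional.Properties using (∈-toList⁺) renaming (∈-lookup to ∈-lookupᵥ)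
open import Data.Vec.Properties using (∷-injective; length-toList; toList∘fromList; tabulate-cong; tabulate∘lookup; lookup∘tabulate)
import Data.Vec.Relation.Unary.All as VecAll
open import Data.Vec.Relation.Unary.All.Properties using (lookup⁺)
open import Function.Base using (_∘_; id; const)
open import Function.Bundles using (_⇔_; mk⇔; Equivalence)
open import Function.Definitions using (Injective)
open import Level using (0ℓ)
open import Relation.Binary.Definitions using (tri<; tri≈; tri>)
open import Relation.Binary.PropositionalEquality using (_≡_; _≢_; refl; sym; trans; cong; cong₂; subst; subst₂; module ≡-Reasoning)
open import Relation.Nullary using (¬_)
open import Relation.Nullary.Decidable using (yes; no; does; ⌊_⌋; ¬?; _×-dec_; _→-dec_; toWitness; fromWitness)
open import Relation.Unary using (Pred; Decidable)
open import Defs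

open Equivalence using (to; from)

private variable A B C : Set

-- Sums and averaging inequalities

∑ : List A → (A → ℕ) → ℕ
∑ []       f = 0
∑ (x ∷ xs) f = f x + ∑ xs f

infix 5 ∑
syntax ∑ L (λ x → e) = ∑[ x ∈ L ] e

𝟙 : Bool → ℕ
𝟙 true  = 1
𝟙 false = 0

𝟙≤1 : ∀ b → 𝟙 b ≤ 1
𝟙≤1 true  = ≤-refl
𝟙≤1 false = z≤n

𝟙-∧ : ∀ a b → 𝟙 (a ∧ b) ≡ 𝟙 a * 𝟙 b
𝟙-∧ true  b = sym (+-identityʳ (𝟙 b))
𝟙-∧ false b = refl

𝟙-not-∧ : ∀ a b → 𝟙 (not (a ∧ b)) ≤ 𝟙 (not a) + 𝟙 (not b)
𝟙-not-∧ true  b = ≤-refl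
𝟙-not-∧ false b = s≤s z≤n

∑-cong : ∀ (L : List A) {f g : A → ℕ} → (∀ x → f x ≡ g x) → ∑ L f ≡ ∑ L g
∑-cong []      f≗g = refl
∑-cong (x ∷ L) f≗g = cong₂ _+_ (f≗g x) (∑-cong L f≗g)

∑-mono-≤ : ∀ (L : List A) {f g : A → ℕ} → (∀ x → f x ≤ g x) → ∑ L f ≤ ∑ L g
∑-mono-≤ []      f≤g = z≤n
∑-mono-≤ (x ∷ L) f≤g = +-mono-≤ (f≤g x) (∑-mono-≤ L f≤g)

∑-distrib-+ : ∀ (L : List A) (f g : A → ℕ) → ∑[ x ∈ L ] f x + g x ≡ ∑ L f + ∑ L g
∑-distrib-+ []      f g = refl
∑-distrib-+ (x ∷ L) f g =
  trans (cong (f x + g x +_) (∑-distrib-+ L f g)) (+-interchange (f x) (g x) (∑ L f) (∑ L g))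

∑-*ˡ : ∀ (L : List A) c (f : A → ℕ) → ∑[ x ∈ L ] c * f x ≡ c * ∑ L f
∑-*ˡ []      c f = sym (*-zeroʳ c)
∑-*ˡ (x ∷ L) c f = trans (cong (c * f x +_) (∑-*ˡ L c f)) (sym (*-distribˡ-+ c (f x) (∑ L f)))

∑-*ʳ : ∀ (L : List A) c (f : A → ℕ) → ∑[ x ∈ L ] f x * c ≡ ∑ L f * c
∑-*ʳ L c f = begin
  ∑[ x ∈ L ] f x * c ≡⟨ ∑-cong L (λ x → *-comm (f x) c) ⟩
  ∑[ x ∈ L ] c * f x ≡⟨ ∑-*ˡ L c f ⟩
  c * ∑ L f          ≡⟨ *-comm c (∑ L f) ⟩
  ∑ L f * c          ∎
  where open ≡-Reasoning

∑-const : ∀ (L : List A) c → ∑[ _ ∈ L ] c ≡ length L * c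
∑-const []      c = refl
∑-const (x ∷ L) c = cong (c +_) (∑-const L c)

∑-1≡length : ∀ (L : List A) → ∑[ _ ∈ L ] 1 ≡ length L
∑-1≡length L = trans (∑-const L 1) (*-identityʳ (length L))

∑-𝟙≤length : ∀ (L : List A) (p : A → Bool) → ∑[ x ∈ L ] 𝟙 (p x) ≤ length L
∑-𝟙≤length L p = ≤-trans (∑-mono-≤ L (λ x → 𝟙≤1 (p x))) (≤-reflexive (∑-1≡length L))

∑-++ : ∀ (L M : List A) f → ∑ (L ++ M) f ≡ ∑ L f + ∑ M f
∑-++ []      M f = refl
∑-++ (x ∷ L) M f = trans (cong (f x +_) (∑-++ L M f)) (sym (+-assoc (f x) (∑ L f) (∑ M f)))

∑-map : ∀ (L : List A) (g : A → B) f → ∑ (map g L) f ≡ ∑[ x ∈ L ] f (g x)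
∑-map []      g f = refl
∑-map (x ∷ L) g f = cong (f (g x) +_) (∑-map L g f)

∑-comm : ∀ (L : List A) (M : List B) (f : A → B → ℕ) → ∑[ x ∈ L ] ∑[ y ∈ M ] f x y ≡ ∑[ y ∈ M ] ∑[ x ∈ L ] f x y
∑-comm []      M f = sym (trans (∑-const M 0) (*-zeroʳ (length M)))
∑-comm (x ∷ L) M f = trans (cong (∑ M (f x) +_) (∑-comm L M f)) (sym (∑-distrib-+ M (f x) _))

rearrangement : ∀ {a b c d} → a ≤ b → c ≤ d → a * d + b * c ≤ a * c + b * d
rearrangement {a} {c = c} a≤b c≤d with m≤n⇒∃[o]m+o≡n a≤b | m≤n⇒∃[o]m+o≡n c≤d
... | i , refl | j , refl = ≤-trans (m≤m+n _ (i * j)) (≤-reflexive (identity a i c j))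
  where
  identity : ∀ a i c j → a * (c + j) + (a + i) * c + i * j ≡ a * c + (a + i) * (c + j)
  identity = solve-∀

chebyshev : ∀ (L : List A) (f g : A → ℕ) → (∀ x y → f x ≤ f y → g x ≤ g y) →
            ∑ L f * ∑ L g ≤ length L * (∑[ x ∈ L ] f x * g x)
chebyshev L f g similarlyOrdered = *-cancelˡ-≤ 2 (begin
  2 * (∑ L f * ∑ L g)                                    ≡⟨ sym ∑f∑g ⟩
  ∑[ x ∈ L ] ∑[ y ∈ L ] (f x * g y + f y * g x)         ≤⟨ ∑-mono-≤ L (λ x → ∑-mono-≤ L (pairwise x)) ⟩
  ∑[ x ∈ L ] ∑[ y ∈ L ] (f x * g x + f y * g y)         ≡⟨ N∑fg ⟩
  2 * (length L * (∑[ x ∈ L ] f x * g x))               ∎)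
  where
  open ≤-Reasoning
  pairwise : ∀ x y → f x * g y + f y * g x ≤ f x * g x + f y * g y
  pairwise x y with ≤-total (f x) (f y)
  ... | inj₁ fx≤fy = rearrangement fx≤fy (similarlyOrdered x y fx≤fy)
  ... | inj₂ fy≤fx = subst₂ _≤_ (+-comm (f y * g x) (f x * g y)) (+-comm (f y * g y) (f x * g x))
                       (rearrangement fy≤fx (similarlyOrdered y x fy≤fx))
  double : ∀ S → S + S ≡ 2 * S
  double S = cong (S +_) (sym (+-identityʳ S))
  ∑f∑g : ∑[ x ∈ L ] ∑[ y ∈ L ] (f x * g y + f y * g x) ≡ 2 * (∑ L f * ∑ L g)
  ∑f∑g = begin-equality
    ∑[ x ∈ L ] ∑[ y ∈ L ] (f x * g y + f y * g x)
      ≡⟨ ∑-cong L (λ x → trans (∑-distrib-+ L _ _) (cong₂ _+_ (∑-*ˡ L (f x) g) (∑-*ʳ L (g x) f))) ⟩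
    ∑[ x ∈ L ] f x * ∑ L g + ∑ L f * g x
      ≡⟨ trans (∑-distrib-+ L _ _) (cong₂ _+_ (∑-*ʳ L (∑ L g) f) (∑-*ˡ L (∑ L f) g)) ⟩
    ∑ L f * ∑ L g + ∑ L f * ∑ L g
      ≡⟨ double (∑ L f * ∑ L g) ⟩
    2 * (∑ L f * ∑ L g) ∎
  N∑fg : ∑[ x ∈ L ] ∑[ y ∈ L ] (f x * g x + f y * g y) ≡ 2 * (length L * (∑[ x ∈ L ] f x * g x))
  N∑fg = begin-equality
    ∑[ x ∈ L ] ∑[ y ∈ L ] (f x * g x + f y * g y)
      ≡⟨ ∑-cong L (λ x → trans (∑-distrib-+ L _ _) (cong (_+ _) (∑-const L (f x * g x)))) ⟩
    ∑[ x ∈ L ] length L * (f x * g x) + (∑[ y ∈ L ] f y * g y)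
      ≡⟨ trans (∑-distrib-+ L _ _) (cong₂ _+_ (∑-*ˡ L (length L) _) (∑-const L _)) ⟩
    length L * (∑[ x ∈ L ] f x * g x) + length L * (∑[ x ∈ L ] f x * g x)
      ≡⟨ double (length L * (∑[ x ∈ L ] f x * g x)) ⟩
    2 * (length L * (∑[ x ∈ L ] f x * g x)) ∎

power-mean : ∀ (L : List A) (f : A → ℕ) q → length L * ∑ L f ^ q ≤ length L ^ q * (∑[ x ∈ L ] f x ^ q)
power-mean L f zero = ≤-reflexive (begin-equality
  length L * 1           ≡⟨ sym (∑-const L 1) ⟩
  ∑[ _ ∈ L ] 1           ≡⟨ sym (*-identityˡ _) ⟩
  1 * (∑[ _ ∈ L ] 1)     ∎)
  where open ≤-Reasoning
power-mean L f (suc q) = begin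
  N * (S * S ^ q)                          ≡⟨ x*[y*z]≡y*[x*z] N S (S ^ q) ⟩
  S * (N * S ^ q)                          ≤⟨ *-monoʳ-≤ S (power-mean L f q) ⟩
  S * (N ^ q * (∑[ x ∈ L ] f x ^ q))       ≡⟨ x*[y*z]≡y*[x*z] S (N ^ q) _ ⟩
  N ^ q * (S * (∑[ x ∈ L ] f x ^ q))       ≤⟨ *-monoʳ-≤ (N ^ q) (chebyshev L f (λ x → f x ^ q) (λ x y → ^-monoˡ-≤ q)) ⟩
  N ^ q * (N * (∑[ x ∈ L ] f x ^ suc q))   ≡⟨ x*[y*z]≡y*x*z (N ^ q) N _ ⟩
  N * N ^ q * (∑[ x ∈ L ] f x ^ suc q)     ∎
  where
  open ≤-Reasoning
  N = length L
  S = ∑ L f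

^-distribʳ-* : ∀ m n o → (m * n) ^ o ≡ m ^ o * n ^ o
^-distribʳ-* m n zero    = refl
^-distribʳ-* m n (suc o) = trans (cong (m * n *_) (^-distribʳ-* m n o)) (*-interchange m n (m ^ o) (n ^ o))

-- N ^ a * x ≤ N ^ b * y is the density inequality x / N ^ b ≤ y / N ^ a, kept free of division.
module ScaledInequality (N : ℕ) where

  scaled-trans : ∀ a b c d {x y z} → N ^ a * x ≤ N ^ b * y → N ^ c * y ≤ N ^ d * z →
                 N ^ (a + c) * x ≤ N ^ (b + d) * z
  scaled-trans a b c d {x} {y} {z} xy yz = begin
    N ^ (a + c) * x       ≡⟨ cong (_* x) (^-distribˡ-+-* N a c) ⟩
    N ^ a * N ^ c * x     ≡⟨ x*y*z≡y*[x*z] (N ^ a) (N ^ c) x ⟩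
    N ^ c * (N ^ a * x)   ≤⟨ *-monoʳ-≤ (N ^ c) xy ⟩
    N ^ c * (N ^ b * y)   ≡⟨ x*[y*z]≡y*[x*z] (N ^ c) (N ^ b) y ⟩
    N ^ b * (N ^ c * y)   ≤⟨ *-monoʳ-≤ (N ^ b) yz ⟩
    N ^ b * (N ^ d * z)   ≡⟨ sym (trans (cong (_* z) (^-distribˡ-+-* N b d)) (*-assoc (N ^ b) (N ^ d) z)) ⟩
    N ^ (b + d) * z       ∎
    where
    open ≤-Reasoning

  scaled-^ : ∀ a b t {x y} → N ^ a * x ≤ N ^ b * y → N ^ (a * t) * x ^ t ≤ N ^ (b * t) * y ^ t
  scaled-^ a b t {x} {y} xy = begin
    N ^ (a * t) * x ^ t   ≡⟨ cong (_* x ^ t) (sym (^-*-assoc N a t)) ⟩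
    (N ^ a) ^ t * x ^ t   ≡⟨ sym (^-distribʳ-* (N ^ a) x t) ⟩
    (N ^ a * x) ^ t       ≤⟨ ^-monoˡ-≤ t xy ⟩
    (N ^ b * y) ^ t       ≡⟨ ^-distribʳ-* (N ^ b) y t ⟩
    (N ^ b) ^ t * y ^ t   ≡⟨ cong (_* y ^ t) (^-*-assoc N b t) ⟩
    N ^ (b * t) * y ^ t   ∎
    where open ≤-Reasoning

  scaled-cancel : .{{_ : NonZero N}} → ∀ a b k {x y} → N ^ (a + k) * x ≤ N ^ (b + k) * y → N ^ a * x ≤ N ^ b * y
  scaled-cancel a b k {x} {y} xy = *-cancelˡ-≤ (N ^ k) {{m^n≢0 N k}} (begin
    N ^ k * (N ^ a * x)   ≡⟨ shift a x ⟩
    N ^ (a + k) * x       ≤⟨ xy ⟩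
    N ^ (b + k) * y       ≡⟨ sym (shift b y) ⟩
    N ^ k * (N ^ b * y)   ∎)
    where
    open ≤-Reasoning
    shift : ∀ e z → N ^ k * (N ^ e * z) ≡ N ^ (e + k) * z
    shift e z = begin-equality
      N ^ k * (N ^ e * z)  ≡⟨ sym (*-assoc (N ^ k) (N ^ e) z) ⟩
      N ^ k * N ^ e * z    ≡⟨ cong (_* z) (sym (^-distribˡ-+-* N k e)) ⟩
      N ^ (k + e) * z      ≡⟨ cong (λ i → N ^ i * z) (+-comm k e) ⟩
      N ^ (e + k) * z      ∎

-- Tuples and subsets

vecs : List A → (k : ℕ) → List (Vec A k)
vecs L zero    = [] ∷ []
vecs L (suc k) = cartesianProductWith _∷_ L (vecs L k)

∑-cartesianProductWith : ∀ (f : A → B → C) (L : List A) (M : List B) g →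
  ∑ (cartesianProductWith f L M) g ≡ ∑[ a ∈ L ] ∑[ b ∈ M ] g (f a b)
∑-cartesianProductWith f []      M g = refl
∑-cartesianProductWith f (a ∷ L) M g = begin
  ∑ (map (f a) M ++ cartesianProductWith f L M) g
    ≡⟨ ∑-++ (map (f a) M) _ g ⟩
  ∑ (map (f a) M) g + ∑ (cartesianProductWith f L M) g
    ≡⟨ cong₂ _+_ (∑-map M (f a) g) (∑-cartesianProductWith f L M g) ⟩
  (∑[ b ∈ M ] g (f a b)) + (∑[ a ∈ L ] ∑[ b ∈ M ] g (f a b)) ∎
  where open ≡-Reasoning

∑-vecs : ∀ (L : List A) k (f : Vec A (suc k) → ℕ) →
         ∑ (vecs L (suc k)) f ≡ ∑[ a ∈ L ] ∑[ v ∈ vecs L k ] f (a ∷ v)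
∑-vecs L k = ∑-cartesianProductWith _∷_ L (vecs L k)

length-vecs : ∀ (L : List A) k → length (vecs L k) ≡ length L ^ k
length-vecs L k = trans (sym (∑-1≡length (vecs L k))) (∑1 k)
  where
  ∑1 : ∀ k → ∑[ _ ∈ vecs L k ] 1 ≡ length L ^ k
  ∑1 zero    = refl
  ∑1 (suc k) = begin
    ∑[ _ ∈ vecs L (suc k) ] 1            ≡⟨ ∑-vecs L k _ ⟩
    ∑[ a ∈ L ] ∑[ _ ∈ vecs L k ] 1       ≡⟨ ∑-cong L (λ _ → ∑1 k) ⟩
    ∑[ a ∈ L ] length L ^ k              ≡⟨ ∑-const L _ ⟩
    length L * length L ^ k              ∎
    where open ≡-Reasoning

∈-vecs : ∀ {L : List A} → (∀ a → a ∈ L) → ∀ {k} (v : Vec A k) → v ∈ vecs L k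
∈-vecs ∈L []      = here refl
∈-vecs ∈L (a ∷ v) = ∈-cartesianProductWith⁺ _∷_ (∈L a) (∈-vecs ∈L v)

vecs-unique : ∀ {L : List A} → Unique L → ∀ k → Unique (vecs L k)
vecs-unique uL zero    = [] ∷ []
vecs-unique uL (suc k) = Unique.cartesianProductWith⁺ _∷_ ∷-injective uL (vecs-unique uL k)

booleans : List Bool
booleans = true ∷ false ∷ []

allSubsets≡vecs : ∀ n → allSubsets n ≡ vecs booleans n
allSubsets≡vecs zero    = refl
allSubsets≡vecs (suc n) rewrite allSubsets≡vecs n = cong (map (true ∷_) (vecs booleans n) ++_) (sym (++-identityʳ _))

∈-allSubsets : ∀ {n} (S : Vec Bool n) → S ∈ allSubsets n
∈-allSubsets {n} S rewrite allSubsets≡vecs n = ∈-vecs ∈-booleans S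
  where
  ∈-booleans : ∀ b → b ∈ booleans
  ∈-booleans true  = here refl
  ∈-booleans false = there (here refl)

allSubsets-unique : ∀ n → Unique (allSubsets n)
allSubsets-unique n rewrite allSubsets≡vecs n = vecs-unique (((λ ()) ∷ []) ∷ [] ∷ []) n

length-filter≡∑ : ∀ {P : Pred A 0ℓ} (P? : Decidable P) L → length (filter P? L) ≡ ∑[ x ∈ L ] 𝟙 (does (P? x))
length-filter≡∑ P? []      = refl
length-filter≡∑ P? (x ∷ L) with does (P? x)
... | true  = cong suc (length-filter≡∑ P? L)
... | false = length-filter≡∑ P? L

∑𝟙>0⇒∃ : ∀ {P : Pred A 0ℓ} (P? : Decidable P) L → 0 < ∑[ x ∈ L ] 𝟙 (does (P? x)) → ∃ P
∑𝟙>0⇒∃ P? (x ∷ L) pos with P? x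
... | yes px = x , px
... | no  _  = ∑𝟙>0⇒∃ P? L pos

∑𝟙¬Q<∑𝟙P⇒∃P×Q : ∀ {P Q : Pred A 0ℓ} (P? : Decidable P) (Q? : Decidable Q) L →
  ∑[ x ∈ L ] 𝟙 (not (does (Q? x))) < ∑[ x ∈ L ] 𝟙 (does (P? x)) → ∃ λ x → P x × Q x
∑𝟙¬Q<∑𝟙P⇒∃P×Q P? Q? L ¬Q<P = ∑𝟙>0⇒∃ (λ x → P? x ×-dec Q? x) L (+-cancelʳ-< _ 0 _ (begin-strict
  ∑[ x ∈ L ] 𝟙 (not (does (Q? x)))
    <⟨ ¬Q<P ⟩
  ∑[ x ∈ L ] 𝟙 (does (P? x))
    ≤⟨ ∑-mono-≤ L (λ x → 𝟙-split (does (P? x)) (does (Q? x))) ⟩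
  ∑[ x ∈ L ] 𝟙 (does (P? x) ∧ does (Q? x)) + 𝟙 (not (does (Q? x)))
    ≡⟨ ∑-distrib-+ L _ _ ⟩
  (∑[ x ∈ L ] 𝟙 (does (P? x) ∧ does (Q? x))) + (∑[ x ∈ L ] 𝟙 (not (does (Q? x)))) ∎))
  where
  open ≤-Reasoning
  𝟙-split : ∀ a b → 𝟙 a ≤ 𝟙 (a ∧ b) + 𝟙 (not b)
  𝟙-split true  true  = ≤-refl
  𝟙-split true  false = ≤-refl
  𝟙-split false b     = z≤n

Unique-⊆⇒length≤ : ∀ {xs ys : List A} → Unique xs → xs ⊆ ys → length xs ≤ length ys
Unique-⊆⇒length≤ {xs = []}     _              _     = z≤n
Unique-⊆⇒length≤ {xs = x ∷ xs} {ys} (x∉xs ∷ uxs) xs⊆ys = begin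
  suc (length xs)          ≤⟨ s≤s (Unique-⊆⇒length≤ uxs xs⊆ys─x) ⟩
  suc (length (ys ─ x∈ys)) ≡⟨ sym (length-removeAt′ ys (index x∈ys)) ⟩
  length ys                ∎
  where
  open ≤-Reasoning
  x∈ys = xs⊆ys (here refl)
  ∈-─ : ∀ {zs} {y} (x∈zs : x ∈ zs) → y ∈ zs → y ≢ x → y ∈ zs ─ x∈zs
  ∈-─ (here refl) (here refl) y≢x = ⊥-elim (y≢x refl)
  ∈-─ (here refl) (there y∈)  _   = y∈
  ∈-─ (there x∈)  (here refl) _   = here refl
  ∈-─ (there x∈)  (there y∈)  y≢x = there (∈-─ x∈ y∈ y≢x)
  xs⊆ys─x : xs ⊆ ys ─ x∈ys
  xs⊆ys─x y∈xs = ∈-─ x∈ys (xs⊆ys (there y∈xs)) (λ y≡x → All.lookup x∉xs y∈xs (sym y≡x))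

∑-allFin-suc : ∀ {n} (f : Fin (suc n) → ℕ) → ∑ (allFin (suc n)) f ≡ f zero + (∑[ a ∈ allFin n ] f (suc a))
∑-allFin-suc {n} f = cong (f zero +_) (trans (cong (λ L → ∑ L f) (sym (map-tabulate id suc))) (∑-map (allFin n) suc f))

∑-𝟙-≟ : ∀ {n} (y : Fin n) → ∑[ a ∈ allFin n ] 𝟙 (does (a ≟ y)) ≡ 1
∑-𝟙-≟ {suc n} zero    = trans (∑-allFin-suc {n} (λ a → 𝟙 (does (a ≟ zero))))
                                (cong suc (trans (∑-const (allFin n) 0) (*-zeroʳ (length (allFin n)))))
∑-𝟙-≟ {suc n} (suc y) = trans (∑-allFin-suc {n} (λ a → 𝟙 (does (a ≟ suc y)))) (∑-𝟙-≟ y)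

T-≡ᵇ : ∀ {a b} → T (a ≡ᵇ b) ⇔ a ≡ b
T-≡ᵇ = mk⇔ (sound _ _) complete
  where
  sound : ∀ a b → T (a ≡ᵇ b) → a ≡ b
  sound zero    zero    _ = refl
  sound (suc a) (suc b) h = cong suc (sound a b h)
  complete : ∀ {a b} → a ≡ b → T (a ≡ᵇ b)
  complete {zero}  refl = tt
  complete {suc a} refl = complete {a} refl

T-allᵇ : ∀ {A : Set} {p : A → Bool} {xs} → T (allᵇ p xs) ⇔ All (T ∘ p) xs
T-allᵇ {p = p} = mk⇔ (sound _) complete
  where
  sound : ∀ xs → T (allᵇ p xs) → All (T ∘ p) xs
  sound []       _ = []
  sound (x ∷ xs) h = proj₁ (to T-∧ h) ∷ sound xs (proj₂ (to T-∧ h))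
  complete : ∀ {xs} → All (T ∘ p) xs → T (allᵇ p xs)
  complete []         = tt
  complete (px ∷ pxs) = from T-∧ (px , complete pxs)

T-⊆ᵇ : ∀ {n} {p q : Subset n} → T (p ⊆ᵇ q) ⇔ p ⊆ₛ q
T-⊆ᵇ = mk⇔ (sound _ _) (complete _ _)
  where
  sound : ∀ {n} (p q : Subset n) → T (p ⊆ᵇ q) → p ⊆ₛ q
  sound (true ∷ p) (true ∷ q) h Vec.here          = Vec.here
  sound (a ∷ p)    (b ∷ q)    h (Vec.there x∈p)   = Vec.there (sound p q (proj₂ (to (T-∧ {not a ∨ b}) h)) x∈p)
  complete : ∀ {n} (p q : Subset n) → p ⊆ₛ q → T (p ⊆ᵇ q)
  complete []          []      _   = tt
  complete (false ∷ p) (b ∷ q) p⊆q = complete p q (drop-∷-⊆ p⊆q)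
  complete (true ∷ p)  (b ∷ q) p⊆q with p⊆q Vec.here
  ... | Vec.here = complete p q (drop-∷-⊆ p⊆q)

∈-setOf : ∀ {n} {x : Fin n} (xs : List (Fin n)) → x ∈ₛ setOf xs ⇔ x ∈ xs
∈-setOf []                = mk⇔ (⊥-elim ∘ ∉⊥) λ ()
∈-setOf {x = x} (y ∷ xs) = mk⇔ sound complete
  where
  sound : x ∈ₛ ⁅ y ⁆ ∪ setOf xs → x ∈ y ∷ xs
  sound x∈ = [ here ∘ x∈⁅y⁆⇒x≡y y , there ∘ to (∈-setOf xs) ] (x∈p∪q⁻ ⁅ y ⁆ (setOf xs) x∈)
  complete : x ∈ y ∷ xs → x ∈ₛ ⁅ y ⁆ ∪ setOf xs
  complete (here refl) = x∈p∪q⁺ (inj₁ (x∈⁅x⁆ y))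
  complete (there x∈)  = x∈p∪q⁺ (inj₂ (from (∈-setOf xs) x∈))

∣⁅x⁆∪p∣≡1+∣p∣ : ∀ {n} (x : Fin n) (p : Subset n) → x ∉ₛ p → ∣ ⁅ x ⁆ ∪ p ∣ ≡ suc ∣ p ∣
∣⁅x⁆∪p∣≡1+∣p∣ zero    (true  ∷ p) x∉p = ⊥-elim (x∉p Vec.here)
∣⁅x⁆∪p∣≡1+∣p∣ zero    (false ∷ p) _   = cong (suc ∘ ∣_∣) (∪-identityˡ p)
∣⁅x⁆∪p∣≡1+∣p∣ (suc x) (true  ∷ p) x∉p = cong suc (∣⁅x⁆∪p∣≡1+∣p∣ x p (x∉p ∘ Vec.there))
∣⁅x⁆∪p∣≡1+∣p∣ (suc x) (false ∷ p) x∉p = ∣⁅x⁆∪p∣≡1+∣p∣ x p (x∉p ∘ Vec.there)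

∣setOf∣≡length : ∀ {n} {xs : List (Fin n)} → Unique xs → ∣ setOf xs ∣ ≡ length xs
∣setOf∣≡length {n} {[]}     _            = ∣⊥∣≡0 n
∣setOf∣≡length {xs = x ∷ xs} (x∉xs ∷ uxs) =
  trans (∣⁅x⁆∪p∣≡1+∣p∣ x (setOf xs) (λ x∈ → All.lookup x∉xs (to (∈-setOf xs) x∈) refl))
        (cong suc (∣setOf∣≡length uxs))

elements : ∀ {n} → Subset n → List (Fin n)
elements {n} S = filter (_∈? S) (allFin n)

∈-elements : ∀ {n} {S : Subset n} {x} → x ∈ elements S ⇔ x ∈ₛ S
∈-elements {n} {S} = mk⇔ (proj₂ ∘ ∈-filter⁻ (_∈? S) {xs = allFin n}) (∈-filter⁺ (_∈? S) (∈-allFin _))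

elements-unique : ∀ {n} (S : Subset n) → Unique (elements S)
elements-unique {n} S = Unique.filter⁺ (_∈? S) (Unique.allFin⁺ n)

setOf-elements : ∀ {n} (S : Subset n) → setOf (elements S) ≡ S
setOf-elements S = ⊆-antisym (to ∈-elements ∘ to (∈-setOf (elements S)))
                             (from (∈-setOf (elements S)) ∘ from ∈-elements)

length-elements : ∀ {n} (S : Subset n) → length (elements S) ≡ ∣ S ∣
length-elements S = trans (sym (∣setOf∣≡length (elements-unique S))) (cong ∣_∣ (setOf-elements S))

-- Cliques and clique tuples

T-implication : ∀ {a b c} → T (not (a ∧ b) ∨ c) ⇔ (T a → T b → T c)
T-implication {true}  {true}  = mk⇔ (λ c _ _ → c) (λ f → f tt tt)
T-implication {true}  {false} = mk⇔ (λ _ _ ()) (λ _ → tt)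
T-implication {false}         = mk⇔ (λ _ ()) (λ _ → tt)

T-spansClique : ∀ {r n} {H : RGraph r n} {S} →
                T (spansClique H S) ⇔ (∀ U → U ⊆ₛ S → ∣ U ∣ ≡ r → T (edge H U))
T-spansClique {r} {n} {H} {S} = mk⇔ sound complete
  where
  implication = λ U → T-implication {U ⊆ᵇ S} {∣ U ∣ ≡ᵇ r} {edge H U}
  sound : T (spansClique H S) → ∀ U → U ⊆ₛ S → ∣ U ∣ ≡ r → T (edge H U)
  sound cl U U⊆S ∣U∣≡r =
    to (implication U) (All.lookup (to (T-allᵇ {xs = allSubsets n}) cl) (∈-allSubsets U)) (from T-⊆ᵇ U⊆S) (from T-≡ᵇ ∣U∣≡r)
  complete : (∀ U → U ⊆ₛ S → ∣ U ∣ ≡ r → T (edge H U)) → T (spansClique H S)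
  complete edges = from (T-allᵇ {xs = allSubsets n}) (All.tabulate λ {U} _ →
    from (implication U) λ U⊆S ∣U∣≡r → edges U (to T-⊆ᵇ U⊆S) (to T-≡ᵇ ∣U∣≡r))

CliqueTuple : ∀ {r n s} → RGraph r n → Vec (Fin n) s → Set
CliqueTuple H v = Unique (toList v) × T (spansClique H (setOf (toList v)))

cliqueTuple? : ∀ {r n s} (H : RGraph r n) → Decidable (CliqueTuple {s = s} H)
cliqueTuple? H v = unique? _≟_ (toList v) ×-dec T? (spansClique H (setOf (toList v)))

cliqueTuples : ∀ {r n} → ℕ → RGraph r n → ℕ
cliqueTuples {n = n} s H = ∑[ v ∈ vecs (allFin n) s ] 𝟙 (does (cliqueTuple? H v))

clique⇒cliqueTuple : ∀ {r n s} (H : RGraph r n) {S} → T ((∣ S ∣ ≡ᵇ s) ∧ spansClique H S) →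
                     ∃ λ (v : Vec (Fin n) s) → CliqueTuple H v × setOf (toList v) ≡ S
clique⇒cliqueTuple {n = n} H {S} h = v , (unique-v , subst (T ∘ spansClique H) (sym setOf-v) cl) , setOf-v
  where
  ∣S∣≡s = to T-≡ᵇ (proj₁ (to T-∧ h))
  cl = proj₂ (to T-∧ h)
  toList-subst : ∀ {A : Set} {m k} (eq : m ≡ k) (xs : Vec A m) → toList (subst (Vec A) eq xs) ≡ toList xs
  toList-subst refl xs = refl
  v = subst (Vec (Fin n)) (trans (length-elements S) ∣S∣≡s) (fromList (elements S))
  toList-v : toList v ≡ elements S
  toList-v = trans (toList-subst _ _) (toList∘fromList (elements S))
  unique-v : Unique (toList v)
  unique-v = subst Unique (sym toList-v) (elements-unique S)
  setOf-v : setOf (toList v) ≡ S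
  setOf-v = trans (cong setOf toList-v) (setOf-elements S)

numCliques≤cliqueTuples : ∀ {r n} s (H : RGraph r n) → numCliques s H ≤ cliqueTuples s H
numCliques≤cliqueTuples {n = n} s H = begin
  numCliques s H
    ≤⟨ Unique-⊆⇒length≤ (Unique.filter⁺ isClique? (allSubsets-unique n)) cover ⟩
  length (map (setOf ∘ toList) (filter (cliqueTuple? H) tuples))
    ≡⟨ length-map (setOf ∘ toList) (filter (cliqueTuple? H) tuples) ⟩
  length (filter (cliqueTuple? H) tuples)
    ≡⟨ length-filter≡∑ (cliqueTuple? H) tuples ⟩
  cliqueTuples s H ∎
  where
  open ≤-Reasoning
  tuples = vecs (allFin n) s
  isClique? = λ S → T? ((∣ S ∣ ≡ᵇ s) ∧ spansClique H S)
  cover : filter isClique? (allSubsets n) ⊆ map (setOf ∘ toList) (filter (cliqueTuple? H) tuples)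
  cover {S} S∈ with clique⇒cliqueTuple H (proj₂ (∈-filter⁻ isClique? {xs = allSubsets n} S∈))
  ... | v , ct , setOf-v≡S =
    subst (_∈ _) setOf-v≡S (∈-map⁺ (setOf ∘ toList) (∈-filter⁺ (cliqueTuple? H) (∈-vecs ∈-allFin v) ct))

-- Blow-ups

transversal : ∀ {s t} → Vec (Vec A t) s → (Fin s → Fin t) → Vec A s
transversal B x = tabulate (λ j → lookup (lookup B j) (x j))

-- The box B (s rows of t entries) spans a blow-up of G: every choice of one entry per row lies in G.
AllTransversals : ∀ {s t} → Pred (Vec A s) 0ℓ → Vec (Vec A t) s → Set
AllTransversals G []      = G []
AllTransversals G (b ∷ B) = VecAll.All (λ a → AllTransversals (G ∘ (a ∷_)) B) b

allTransversals? : ∀ {s t} {G : Pred (Vec A s) 0ℓ} → Decidable G → Decidable (AllTransversals {t = t} G)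
allTransversals? G? []      = G? []
allTransversals? G? (b ∷ B) = VecAll.all? (λ a → allTransversals? (G? ∘ (a ∷_)) B) b

AllTransversals⇒∈ : ∀ {s t} {G : Pred (Vec A s) 0ℓ} (B : Vec (Vec A t) s) →
                    AllTransversals G B → ∀ x → G (transversal B x)
AllTransversals⇒∈ []      G[]   x = G[]
AllTransversals⇒∈ (b ∷ B) allTr x = AllTransversals⇒∈ B (lookup⁺ allTr (x zero)) (x ∘ suc)

DistinctRows : ∀ {s t} → Vec (Vec A t) s → Set
DistinctRows = VecAll.All (Unique ∘ toList)

∑-vecs-all : ∀ (L : List A) {P : Pred A 0ℓ} (P? : Decidable P) t →
             ∑[ b ∈ vecs L t ] 𝟙 (does (VecAll.all? P? b)) ≡ (∑[ a ∈ L ] 𝟙 (does (P? a))) ^ t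
∑-vecs-all L P? zero    = refl
∑-vecs-all L P? (suc t) = begin
  ∑[ b ∈ vecs L (suc t) ] 𝟙 (does (VecAll.all? P? b))
    ≡⟨ ∑-vecs L t _ ⟩
  ∑[ a ∈ L ] ∑[ b ∈ vecs L t ] 𝟙 (does (P? a) ∧ does (VecAll.all? P? b))
    ≡⟨ ∑-cong L (λ a → trans (∑-cong (vecs L t) (λ b → 𝟙-∧ (does (P? a)) _)) (∑-*ˡ (vecs L t) (𝟙 (does (P? a))) _)) ⟩
  ∑[ a ∈ L ] 𝟙 (does (P? a)) * (∑[ b ∈ vecs L t ] 𝟙 (does (VecAll.all? P? b)))
    ≡⟨ ∑-*ʳ L _ _ ⟩
  S * (∑[ b ∈ vecs L t ] 𝟙 (does (VecAll.all? P? b)))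
    ≡⟨ cong (S *_) (∑-vecs-all L P? t) ⟩
  S * S ^ t ∎
  where
  open ≡-Reasoning
  S = ∑[ a ∈ L ] 𝟙 (does (P? a))

module BlowupCounting (L : List A) (t : ℕ) where

  N : ℕ
  N = length L

  count : ∀ {s} {G : Pred (Vec A s) 0ℓ} → Decidable G → ℕ
  count {s} G? = ∑[ v ∈ vecs L s ] 𝟙 (does (G? v))

  boxes : ∀ s → List (Vec (Vec A t) s)
  boxes s = vecs (vecs L t) s

  blowups : ∀ {s} {G : Pred (Vec A s) 0ℓ} → Decidable G → ℕ
  blowups {s} G? = ∑[ B ∈ boxes s ] 𝟙 (does (allTransversals? G? B))

  length-boxes : ∀ s → length (boxes s) ≡ N ^ (s * t)
  length-boxes s = begin
    length (vecs (vecs L t) s) ≡⟨ length-vecs (vecs L t) s ⟩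
    length (vecs L t) ^ s      ≡⟨ cong (_^ s) (length-vecs L t) ⟩
    (N ^ t) ^ s                ≡⟨ ^-*-assoc N t s ⟩
    N ^ (t * s)                ≡⟨ cong (N ^_) (*-comm t s) ⟩
    N ^ (s * t)                ∎
    where open ≡-Reasoning

  module _ {s} {G : Pred (Vec A (suc s)) 0ℓ} (G? : Decidable G) where

    slice? : ∀ a → Decidable (G ∘ (a ∷_))
    slice? a = G? ∘ (a ∷_)

    sliceBlowups : Vec (Vec A t) s → ℕ
    sliceBlowups B = ∑[ a ∈ L ] 𝟙 (does (allTransversals? (slice? a) B))

    count-slices : count G? ≡ ∑[ a ∈ L ] count (slice? a)
    count-slices = ∑-vecs L s _

    blowups-slices : blowups G? ≡ ∑[ B ∈ boxes s ] sliceBlowups B ^ t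
    blowups-slices = begin
      blowups G?
        ≡⟨ ∑-vecs (vecs L t) s _ ⟩
      ∑[ b ∈ vecs L t ] ∑[ B ∈ boxes s ] 𝟙 (does (VecAll.all? (λ a → allTransversals? (slice? a) B) b))
        ≡⟨ ∑-comm (vecs L t) (boxes s) _ ⟩
      ∑[ B ∈ boxes s ] ∑[ b ∈ vecs L t ] 𝟙 (does (VecAll.all? (λ a → allTransversals? (slice? a) B) b))
        ≡⟨ ∑-cong (boxes s) (λ B → ∑-vecs-all L (λ a → allTransversals? (slice? a) B) t) ⟩
      ∑[ B ∈ boxes s ] sliceBlowups B ^ t ∎
      where open ≡-Reasoning

    ∑-sliceBlowups : ∑[ B ∈ boxes s ] sliceBlowups B ≡ ∑[ a ∈ L ] blowups (slice? a)
    ∑-sliceBlowups = ∑-comm (boxes s) L _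

    count-power-mean : N ^ 1 * count G? ^ (t ^ s) ≤ N ^ (t ^ s) * (∑[ a ∈ L ] count (slice? a) ^ (t ^ s))
    count-power-mean = begin
      N ^ 1 * count G? ^ (t ^ s)                    ≡⟨ cong₂ (λ x y → x * y ^ (t ^ s)) (*-identityʳ N) count-slices ⟩
      N * (∑[ a ∈ L ] count (slice? a)) ^ (t ^ s)   ≤⟨ power-mean L (count ∘ slice?) (t ^ s) ⟩
      N ^ (t ^ s) * (∑[ a ∈ L ] count (slice? a) ^ (t ^ s)) ∎
      where open ≤-Reasoning

    blowups-power-mean : N ^ (s * t) * (∑[ a ∈ L ] blowups (slice? a)) ^ t ≤ N ^ (s * t * t) * blowups G?
    blowups-power-mean = begin
      N ^ (s * t) * (∑[ a ∈ L ] blowups (slice? a)) ^ t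
        ≡⟨ cong₂ (λ x y → x * y ^ t) (sym (length-boxes s)) (sym ∑-sliceBlowups) ⟩
      length (boxes s) * (∑[ B ∈ boxes s ] sliceBlowups B) ^ t
        ≤⟨ power-mean (boxes s) sliceBlowups t ⟩
      length (boxes s) ^ t * (∑[ B ∈ boxes s ] sliceBlowups B ^ t)
        ≡⟨ cong₂ _*_ (trans (cong (_^ t) (length-boxes s)) (^-*-assoc N (s * t) t)) (sym blowups-slices) ⟩
      N ^ (s * t * t) * blowups G? ∎
      where open ≤-Reasoning

  -- In densities: a random box spans a blow-up of G with probability at least (count G? / N ^ s) ^ (t ^ s).
  -- Slice G along its first coordinate and apply the power-mean inequality over L and over the boxes.
  blowups-lower-bound : .{{_ : NonZero N}} → ∀ s {G : Pred (Vec A s) 0ℓ} (G? : Decidable G) →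
                        N ^ (s * t) * count G? ^ (t ^ s) ≤ N ^ (s * t ^ s) * blowups G?
  blowups-lower-bound zero    G? = ≤-reflexive (cong (1 *_) (*-identityʳ (count G?)))
  blowups-lower-bound (suc s) G? =
    scaled-cancel (suc s * t) (suc s * (t * tˢ)) (s * t * t)
      (subst₂ (λ i j → N ^ i * count G? ^ (t * tˢ) ≤ N ^ j * blowups G?) (exponentˡ s t) (exponentʳ s t tˢ)
        (subst (λ e → N ^ ((1 + s * t) * t + s * t) * e ≤ N ^ ((tˢ + s * tˢ) * t + s * t * t) * blowups G?)
          (trans (^-*-assoc (count G?) tˢ t) (cong (count G? ^_) (*-comm tˢ t)))
          (scaled-trans ((1 + s * t) * t) ((tˢ + s * tˢ) * t) (s * t) (s * t * t)
            (scaled-^ (1 + s * t) (tˢ + s * tˢ) t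
              (scaled-trans 1 tˢ (s * t) (s * tˢ) (count-power-mean G?) slices-bound))
            (blowups-power-mean G?))))
    where
    open ScaledInequality N
    tˢ = t ^ s
    slices-bound : N ^ (s * t) * (∑[ a ∈ L ] count (slice? G? a) ^ tˢ) ≤ N ^ (s * tˢ) * (∑[ a ∈ L ] blowups (slice? G? a))
    slices-bound = begin
      N ^ (s * t) * (∑[ a ∈ L ] count (slice? G? a) ^ tˢ)     ≡⟨ sym (∑-*ˡ L (N ^ (s * t)) _) ⟩
      ∑[ a ∈ L ] N ^ (s * t) * count (slice? G? a) ^ tˢ       ≤⟨ ∑-mono-≤ L (λ a → blowups-lower-bound s (slice? G? a)) ⟩
      ∑[ a ∈ L ] N ^ (s * tˢ) * blowups (slice? G? a)         ≡⟨ ∑-*ˡ L (N ^ (s * tˢ)) _ ⟩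
      N ^ (s * tˢ) * (∑[ a ∈ L ] blowups (slice? G? a))       ∎
      where open ≤-Reasoning
    exponentˡ : ∀ s t → (1 + s * t) * t + s * t ≡ suc s * t + s * t * t
    exponentˡ = solve-∀
    exponentʳ : ∀ s t tˢ → (tˢ + s * tˢ) * t + s * t * t ≡ suc s * (t * tˢ) + s * t * t
    exponentʳ = solve-∀

-- Beyond this many vertices, the blow-ups given by blowups-density outnumber the degenerate boxes.
blowupThreshold : ℕ → ℕ → ℕ → ℕ
blowupThreshold k s t = k ^ (t ^ s) * (s * (t * t))

module DegenerateBoxes (n t : ℕ) where

  open BlowupCounting (allFin n) t

  length-allFin : length (allFin n) ≡ n
  length-allFin = length-tabulate id

  ∑-allFin-const : ∀ c → ∑[ _ ∈ allFin n ] c ≡ n * c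
  ∑-allFin-const c = trans (∑-const (allFin n) c) (cong (_* c) length-allFin)

  fresh : Fin n → List (Fin n) → Bool
  fresh a l = does (All.all? (λ y → ¬? (a ≟ y)) l)

  ∑-𝟙-occurs : ∀ (l : List (Fin n)) → ∑[ a ∈ allFin n ] 𝟙 (not (fresh a l)) ≤ length l
  ∑-𝟙-occurs []      = ≤-reflexive (trans (∑-allFin-const 0) (*-zeroʳ n))
  ∑-𝟙-occurs (y ∷ l) = begin
    ∑[ a ∈ allFin n ] 𝟙 (not (not (does (a ≟ y)) ∧ fresh a l))
      ≤⟨ ∑-mono-≤ (allFin n) (λ a → 𝟙-not-∧-not (does (a ≟ y)) _) ⟩
    ∑[ a ∈ allFin n ] 𝟙 (does (a ≟ y)) + 𝟙 (not (fresh a l))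
      ≡⟨ ∑-distrib-+ (allFin n) _ _ ⟩
    (∑[ a ∈ allFin n ] 𝟙 (does (a ≟ y))) + (∑[ a ∈ allFin n ] 𝟙 (not (fresh a l)))
      ≤⟨ +-mono-≤ (≤-reflexive (∑-𝟙-≟ y)) (∑-𝟙-occurs l) ⟩
    suc (length l) ∎
    where
    open ≤-Reasoning
    𝟙-not-∧-not : ∀ a b → 𝟙 (not (not a ∧ b)) ≤ 𝟙 a + 𝟙 (not b)
    𝟙-not-∧-not true  b = s≤s z≤n
    𝟙-not-∧-not false b = ≤-refl

  distinct : ∀ {k} → Vec (Fin n) k → Bool
  distinct v = does (unique? _≟_ (toList v))

  repeats : ∀ {k} → Vec (Fin n) k → Bool
  repeats v = not (distinct v)

  repeatingTuples : ℕ → ℕ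
  repeatingTuples k = ∑[ v ∈ vecs (allFin n) k ] 𝟙 (repeats v)

  ∑-𝟙-occurs-tuples : ∀ k → ∑[ w ∈ vecs (allFin n) k ] ∑[ a ∈ allFin n ] 𝟙 (not (fresh a (toList w))) ≤ n ^ k * k
  ∑-𝟙-occurs-tuples k = begin
    ∑[ w ∈ vecs (allFin n) k ] ∑[ a ∈ allFin n ] 𝟙 (not (fresh a (toList w)))
      ≤⟨ ∑-mono-≤ (vecs (allFin n) k) (λ w → ≤-trans (∑-𝟙-occurs (toList w)) (≤-reflexive (length-toList w))) ⟩
    ∑[ w ∈ vecs (allFin n) k ] k
      ≡⟨ trans (∑-const (vecs (allFin n) k) k) (cong (_* k) (trans (length-vecs (allFin n) k) (cong (_^ k) length-allFin))) ⟩
    n ^ k * k ∎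
    where open ≤-Reasoning

  -- By the recursion of unique?, distinct (a ∷ w) unfolds to fresh a (toList w) ∧ distinct w.
  repeatingTuples-bound : ∀ k → n * repeatingTuples k ≤ k * k * n ^ k
  repeatingTuples-bound zero    = ≤-reflexive (*-zeroʳ n)
  repeatingTuples-bound (suc k) = begin
    n * repeatingTuples (suc k)
      ≡⟨ cong (n *_) (∑-vecs (allFin n) k _) ⟩
    n * (∑[ a ∈ allFin n ] ∑[ w ∈ tuples ] 𝟙 (not (fresh a (toList w) ∧ distinct w)))
      ≤⟨ *-monoʳ-≤ n (∑-mono-≤ (allFin n) (λ a → ∑-mono-≤ tuples (λ w → 𝟙-not-∧ (fresh a (toList w)) _))) ⟩
    n * (∑[ a ∈ allFin n ] ∑[ w ∈ tuples ] 𝟙 (not (fresh a (toList w))) + 𝟙 (repeats w))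
      ≡⟨ cong (n *_) split ⟩
    n * ((∑[ w ∈ tuples ] ∑[ a ∈ allFin n ] 𝟙 (not (fresh a (toList w)))) + n * repeatingTuples k)
      ≤⟨ *-monoʳ-≤ n (+-mono-≤ (∑-𝟙-occurs-tuples k) (repeatingTuples-bound k)) ⟩
    n * (n ^ k * k + k * k * n ^ k)
      ≡⟨ regroup n k (n ^ k) ⟩
    (k + k * k) * (n * n ^ k)
      ≤⟨ *-monoˡ-≤ (n * n ^ k) (≤-trans (m≤n+m (k + k * k) (suc k)) (≤-reflexive (expand k))) ⟩
    suc k * suc k * (n * n ^ k) ∎
    where
    open ≤-Reasoning
    tuples = vecs (allFin n) k
    split : (∑[ a ∈ allFin n ] ∑[ w ∈ tuples ] 𝟙 (not (fresh a (toList w))) + 𝟙 (repeats w)) ≡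
            (∑[ w ∈ tuples ] ∑[ a ∈ allFin n ] 𝟙 (not (fresh a (toList w)))) + n * repeatingTuples k
    split = begin-equality
      (∑[ a ∈ allFin n ] ∑[ w ∈ tuples ] 𝟙 (not (fresh a (toList w))) + 𝟙 (repeats w))
        ≡⟨ ∑-cong (allFin n) (λ a → ∑-distrib-+ tuples _ _) ⟩
      (∑[ a ∈ allFin n ] (∑[ w ∈ tuples ] 𝟙 (not (fresh a (toList w)))) + repeatingTuples k)
        ≡⟨ ∑-distrib-+ (allFin n) _ _ ⟩
      (∑[ a ∈ allFin n ] ∑[ w ∈ tuples ] 𝟙 (not (fresh a (toList w)))) + (∑[ _ ∈ allFin n ] repeatingTuples k)
        ≡⟨ cong₂ _+_ (∑-comm (allFin n) tuples _) (∑-allFin-const (repeatingTuples k)) ⟩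
      (∑[ w ∈ tuples ] ∑[ a ∈ allFin n ] 𝟙 (not (fresh a (toList w)))) + n * repeatingTuples k ∎
    regroup : ∀ n k p → n * (p * k + k * k * p) ≡ (k + k * k) * (n * p)
    regroup = solve-∀
    expand : ∀ k → suc k + (k + k * k) ≡ suc k * suc k
    expand = solve-∀

  distinctRows? : ∀ {s} → Decidable (DistinctRows {A = Fin n} {s} {t})
  distinctRows? = VecAll.all? (unique? _≟_ ∘ toList)

  degenerateBoxes : ℕ → ℕ
  degenerateBoxes s = ∑[ B ∈ boxes s ] 𝟙 (not (does (distinctRows? B)))

  length-boxes-allFin : ∀ s → length (boxes s) ≡ n ^ (s * t)
  length-boxes-allFin s = trans (length-boxes s) (cong (_^ (s * t)) length-allFin)

  degenerateBoxes-bound : ∀ s → n * degenerateBoxes s ≤ s * (t * t) * n ^ (s * t)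
  degenerateBoxes-bound zero    = ≤-reflexive (*-zeroʳ n)
  degenerateBoxes-bound (suc s) = begin
    n * degenerateBoxes (suc s)
      ≡⟨ cong (n *_) (∑-vecs (vecs (allFin n) t) s _) ⟩
    n * (∑[ b ∈ rows ] ∑[ B ∈ boxes s ] 𝟙 (not (distinct b ∧ does (distinctRows? B))))
      ≤⟨ *-monoʳ-≤ n (∑-mono-≤ rows (λ b → ∑-mono-≤ (boxes s) (λ B → 𝟙-not-∧ (distinct b) _))) ⟩
    n * (∑[ b ∈ rows ] ∑[ B ∈ boxes s ] 𝟙 (repeats b) + 𝟙 (not (does (distinctRows? B))))
      ≡⟨ cong (n *_) split ⟩
    n * (n ^ (s * t) * repeatingTuples t + n ^ t * degenerateBoxes s)
      ≡⟨ distribute n (n ^ (s * t)) (repeatingTuples t) (n ^ t) (degenerateBoxes s) ⟩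
    n ^ (s * t) * (n * repeatingTuples t) + n ^ t * (n * degenerateBoxes s)
      ≤⟨ +-mono-≤ (*-monoʳ-≤ (n ^ (s * t)) (repeatingTuples-bound t)) (*-monoʳ-≤ (n ^ t) (degenerateBoxes-bound s)) ⟩
    n ^ (s * t) * (t * t * n ^ t) + n ^ t * (s * (t * t) * n ^ (s * t))
      ≡⟨ collect (n ^ (s * t)) (t * t) (n ^ t) s ⟩
    suc s * (t * t) * (n ^ t * n ^ (s * t))
      ≡⟨ cong (suc s * (t * t) *_) (sym (^-distribˡ-+-* n t (s * t))) ⟩
    suc s * (t * t) * n ^ (suc s * t) ∎
    where
    open ≤-Reasoning
    rows = vecs (allFin n) t
    split : (∑[ b ∈ rows ] ∑[ B ∈ boxes s ] 𝟙 (repeats b) + 𝟙 (not (does (distinctRows? B)))) ≡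
            n ^ (s * t) * repeatingTuples t + n ^ t * degenerateBoxes s
    split = begin-equality
      (∑[ b ∈ rows ] ∑[ B ∈ boxes s ] 𝟙 (repeats b) + 𝟙 (not (does (distinctRows? B))))
        ≡⟨ ∑-cong rows (λ b → trans (∑-distrib-+ (boxes s) _ _) (cong (_+ degenerateBoxes s) (∑-const (boxes s) _))) ⟩
      (∑[ b ∈ rows ] length (boxes s) * 𝟙 (repeats b) + degenerateBoxes s)
        ≡⟨ trans (∑-distrib-+ rows _ _) (cong₂ _+_ (∑-*ˡ rows (length (boxes s)) (𝟙 ∘ repeats)) (∑-const rows _)) ⟩
      length (boxes s) * repeatingTuples t + length rows * degenerateBoxes s
        ≡⟨ cong₂ (λ x y → x * repeatingTuples t + y * degenerateBoxes s)
                 (length-boxes-allFin s) (trans (length-vecs (allFin n) t) (cong (_^ t) length-allFin)) ⟩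
      n ^ (s * t) * repeatingTuples t + n ^ t * degenerateBoxes s ∎
    distribute : ∀ n p x q y → n * (p * x + q * y) ≡ p * (n * x) + q * (n * y)
    distribute = solve-∀
    collect : ∀ p tt q s → p * (tt * q) + q * (s * tt * p) ≡ suc s * tt * (q * p)
    collect = solve-∀

  distinct-blowup : ∀ {s} {G : Pred (Vec (Fin n) s) 0ℓ} (G? : Decidable G) → degenerateBoxes s < blowups G? →
                    ∃ λ B → AllTransversals G B × DistinctRows B
  distinct-blowup {s} G? = ∑𝟙¬Q<∑𝟙P⇒∃P×Q (allTransversals? G?) distinctRows? (boxes s)

  module _ {{n≢0 : NonZero n}} {s} {G : Pred (Vec (Fin n) s) 0ℓ} (G? : Decidable G) where

    blowups-density : ∀ k → n ^ s ≤ k * count G? → n ^ (s * t) ≤ k ^ (t ^ s) * blowups G?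
    blowups-density k dense = *-cancelˡ-≤ (n ^ (s * tˢ)) {{m^n≢0 n (s * tˢ)}} (begin
      n ^ (s * tˢ) * n ^ (s * t)           ≡⟨ cong (_* n ^ (s * t)) (sym (^-*-assoc n s tˢ)) ⟩
      (n ^ s) ^ tˢ * n ^ (s * t)           ≤⟨ *-monoˡ-≤ (n ^ (s * t)) (^-monoˡ-≤ tˢ dense) ⟩
      (k * count G?) ^ tˢ * n ^ (s * t)    ≡⟨ cong (_* n ^ (s * t)) (^-distribʳ-* k (count G?) tˢ) ⟩
      k ^ tˢ * count G? ^ tˢ * n ^ (s * t)  ≡⟨ x*y*z≡x*[z*y] (k ^ tˢ) (count G? ^ tˢ) (n ^ (s * t)) ⟩
      k ^ tˢ * (n ^ (s * t) * count G? ^ tˢ) ≤⟨ *-monoʳ-≤ (k ^ tˢ) supersaturated ⟩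
      k ^ tˢ * (n ^ (s * tˢ) * blowups G?)   ≡⟨ x*[y*z]≡y*[x*z] (k ^ tˢ) (n ^ (s * tˢ)) (blowups G?) ⟩
      n ^ (s * tˢ) * (k ^ tˢ * blowups G?)   ∎)
      where
      open ≤-Reasoning
      tˢ = t ^ s
      instance
        N≢0 : NonZero (length (allFin n))
        N≢0 = subst NonZero (sym length-allFin) n≢0
      supersaturated : n ^ (s * t) * count G? ^ tˢ ≤ n ^ (s * tˢ) * blowups G?
      supersaturated = subst (λ N → N ^ (s * t) * count G? ^ tˢ ≤ N ^ (s * tˢ) * blowups G?)
                             length-allFin (blowups-lower-bound s G?)

  dense⇒distinct-blowup : ∀ {s k} {G : Pred (Vec (Fin n) s) 0ℓ} (G? : Decidable G) →
                          blowupThreshold k s t < n → n ^ s ≤ k * count G? →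
                          ∃ λ B → AllTransversals G B × DistinctRows B
  dense⇒distinct-blowup {s} {k} G? K<n dense with degenerateBoxes s <? blowups G?
  ... | yes few  = distinct-blowup G? few
  ... | no  many = ⊥-elim (<⇒≱ K<n (*-cancelˡ-≤ (n ^ (s * t)) {{m^n≢0 n (s * t)}} (begin
    n ^ (s * t) * n                         ≡⟨ *-comm (n ^ (s * t)) n ⟩
    n * n ^ (s * t)                         ≤⟨ *-monoʳ-≤ n (blowups-density G? k dense) ⟩
    n * (k ^ tˢ * blowups G?)                ≤⟨ *-monoʳ-≤ n (*-monoʳ-≤ (k ^ tˢ) (≮⇒≥ many)) ⟩
    n * (k ^ tˢ * degenerateBoxes s)         ≡⟨ x*[y*z]≡y*[x*z] n (k ^ tˢ) (degenerateBoxes s) ⟩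
    k ^ tˢ * (n * degenerateBoxes s)         ≤⟨ *-monoʳ-≤ (k ^ tˢ) (degenerateBoxes-bound s) ⟩
    k ^ tˢ * (s * (t * t) * n ^ (s * t))     ≡⟨ x*[y*z]≡z*[x*y] (k ^ tˢ) (s * (t * t)) (n ^ (s * t)) ⟩
    n ^ (s * t) * (k ^ tˢ * (s * (t * t)))   ∎)))
    where
    open ≤-Reasoning
    tˢ = t ^ s
    instance
      n≢0 : NonZero n
      n≢0 = >-nonZero (≤-<-trans z≤n K<n)

-- Embedding the expansion into a blow-up

toList∘tabulate : ∀ {k} (f : Fin k → A) → toList (tabulate f) ≡ List.tabulate f
toList∘tabulate {k = zero}  f = refl
toList∘tabulate {k = suc k} f = cong (f zero ∷_) (toList∘tabulate (f ∘ suc))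

expEdgeVertices : ∀ {m} r (F : Graph m) → EdgeOf F → List (ExpVertex r F)
expEdgeVertices r F e@(u , v , _) = inj₁ u ∷ inj₁ v ∷ List.tabulate (λ i → inj₂ (e , i))

expEdgeImage≡ : ∀ {m n} r (F : Graph m) (ι : ExpVertex r F → Fin n) e →
                expEdgeImage r F ι e ≡ setOf (map ι (expEdgeVertices r F e))
expEdgeImage≡ r F ι e@(u , v , _) =
  cong (λ l → setOf (ι (inj₁ u) ∷ ι (inj₁ v) ∷ l))
       (trans (toList∘tabulate _) (sym (map-tabulate (λ i → inj₂ (e , i)) ι)))

StrongColouring : ∀ {m} r (F : Graph m) s → (ExpVertex r F → Fin s) → Set
StrongColouring r F s col = ∀ e → AllPairs (λ y z → col y ≢ col z) (expEdgeVertices r F e)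

extendPartial : ∀ {s} {B : Set} → B → (ps : List (Fin s × B)) → AllPairs (λ p q → proj₁ p ≢ proj₁ q) ps →
                ∃ λ (x : Vector B s) → All (λ p → x (proj₁ p) ≡ proj₂ p) ps
extendPartial d []             []                     = const d , []
extendPartial d ((j , b) ∷ ps) (j∉ps ∷ ps-functional) with extendPartial d ps ps-functional
... | x , x-extends = updateAt x j (const b) , updateAt-updates j x ∷
  All.zipWith (λ (j≢ , x-ok) → trans (updateAt-minimal _ j x (j≢ ∘ sym)) x-ok) (j∉ps , x-extends)

Unique-lookup-injective : ∀ {k} (v : Vec A k) → Unique (toList v) → ∀ {i j} → lookup v i ≡ lookup v j → i ≡ j
Unique-lookup-injective (x ∷ v) _            {zero}  {zero}  _  = refl
Unique-lookup-injective (x ∷ v) (x∉v ∷ _)    {zero}  {suc j} eq = ⊥-elim (All.lookup x∉v (∈-toList⁺ (∈-lookupᵥ j v)) eq)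
Unique-lookup-injective (x ∷ v) (x∉v ∷ _)    {suc i} {zero}  eq = ⊥-elim (All.lookup x∉v (∈-toList⁺ (∈-lookupᵥ i v)) (sym eq))
Unique-lookup-injective (x ∷ v) (_ ∷ unique) {suc i} {suc j} eq = cong suc (Unique-lookup-injective v unique eq)

module BlowupEmbedding {r₂ n m s t} {H : RGraph (2 + r₂) n} {F : Graph m}
  {col : ExpVertex (2 + r₂) F → Fin s} (strong : StrongColouring (2 + r₂) F s col)
  {code : ExpVertex (2 + r₂) F → Fin t} (code-injective : Injective _≡_ _≡_ code)
  {B : Vec (Vec (Fin n) t) s} (cliques : AllTransversals (CliqueTuple H) B) (rows : DistinctRows B)
  where

  ι : ExpVertex (2 + r₂) F → Fin n
  ι y = lookup (lookup B (col y)) (code y)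

  transversal-through : ∀ d ys → AllPairs (λ y z → col y ≢ col z) ys →
            ∃ λ x → All (λ y → lookup (transversal B x) (col y) ≡ ι y) ys
  transversal-through d ys rainbow with extendPartial d (map (λ y → col y , code y) ys) (AllPairs.map⁺ rainbow)
  ... | x , x-extends = x , All.map (λ {y} x-ok → trans (lookup∘tabulate _ (col y)) (cong (lookup (lookup B (col y))) x-ok))
                                   (All.map⁻ x-extends)

  ι-injective : Injective _≡_ _≡_ ι
  ι-injective {y} {z} ιy≡ιz with col y ≟ col z
  ... | yes cy≡cz = code-injective (Unique-lookup-injective (lookup B (col z)) (lookup⁺ rows (col z))
                                      (subst (λ j → lookup (lookup B j) (code y) ≡ ι z) cy≡cz ιy≡ιz))
  ... | no  cy≢cz with transversal-through (code y) (y ∷ z ∷ []) ((cy≢cz ∷ []) ∷ [] ∷ [])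
  ...   | x , (x-y ∷ x-z ∷ []) = ⊥-elim (cy≢cz (Unique-lookup-injective (transversal B x)
                                   (proj₁ (AllTransversals⇒∈ B cliques x)) (trans x-y (trans ιy≡ιz (sym x-z)))))

  ι-edge : ∀ e → T (edge H (expEdgeImage (2 + r₂) F ι e))
  ι-edge e@(u , _) with transversal-through (code (inj₁ u)) (expEdgeVertices (2 + r₂) F e) (strong e)
  ... | x , x-through = subst (T ∘ edge H) (sym (expEdgeImage≡ (2 + r₂) F ι e))
                          (to (T-spansClique {H = H}) (proj₂ (AllTransversals⇒∈ B cliques x)) _ image⊆ ∣image∣≡r)
    where
    Ys = expEdgeVertices (2 + r₂) F e
    image⊆ : setOf (map ι Ys) ⊆ₛ setOf (toList (transversal B x))
    image⊆ w∈ with ∈-map⁻ ι (to (∈-setOf (map ι Ys)) w∈)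
    ... | y , y∈Ys , refl = from (∈-setOf _) (subst (_∈ _) (All.lookup x-through y∈Ys)
                                                    (∈-toList⁺ (∈-lookupᵥ (col y) (transversal B x))))
    ∣image∣≡r : ∣ setOf (map ι Ys) ∣ ≡ 2 + r₂
    ∣image∣≡r = trans (∣setOf∣≡length (Unique.map⁺ ι-injective (AllPairs.map (λ c≢ y≡z → c≢ (cong col y≡z)) (strong e))))
                      (trans (length-map ι Ys) (cong (2 +_) (length-tabulate (λ i → inj₂ (e , i)))))

  blowup-contains-expansion : ContainsExpansion H F
  blowup-contains-expansion = ι , ι-injective , ι-edge

edgeCode : ∀ {m} {F : Graph m} → EdgeOf F → Fin (m * m)
edgeCode (u , v , _) = combine u v

edgeCode-injective : ∀ {m} {F : Graph m} → Injective _≡_ _≡_ (edgeCode {F = F})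
edgeCode-injective {x = u , v , uv , u<v} {u′ , v′ , uv′ , u′<v′} eq with combine-injective u v u′ v′ eq
... | refl , refl rewrite T-irrelevant uv uv′ | <-irrelevant u<v u′<v′ = refl

expVertexBound : ℕ → ℕ → ℕ
expVertexBound r m = m + m * m * (r ∸ 2)

expVertexCode : ∀ {m} r (F : Graph m) → ExpVertex r F → Fin (expVertexBound r m)
expVertexCode {m} r F = join m _ ∘ Sum.map₂ (λ (e , i) → combine (edgeCode {F = F} e) i)

expVertexCode-injective : ∀ {m} r (F : Graph m) → Injective _≡_ _≡_ (expVertexCode r F)
expVertexCode-injective {m} r F {x} {y} eq = slot-injective x y (join-injective eq)
  where
  join-injective : ∀ {k l} {a b : Fin k ⊎ Fin l} → join k l a ≡ join k l b → a ≡ b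
  join-injective {k} {l} {a} {b} eq = trans (sym (splitAt-join k l a)) (trans (cong (splitAt k) eq) (splitAt-join k l b))
  slot = Sum.map₂ (λ (e , i) → combine (edgeCode {F = F} e) i)
  slot-injective : ∀ (x y : ExpVertex r F) → slot x ≡ slot y → x ≡ y
  slot-injective (inj₁ u)       (inj₁ .u)       refl = refl
  slot-injective (inj₂ (e , i)) (inj₂ (e′ , i′)) eq
    with combine-injective (edgeCode {F = F} e) i (edgeCode {F = F} e′) i′ (inj₂-injective eq)
  ... | e≡e′ , refl = cong (λ e → inj₂ (e , i)) (edgeCode-injective {F = F} e≡e′)

module ColourExtension {r₂ s₂} (r₂≤s₂ : r₂ ≤ s₂) where

  avoiding : (a b : Fin (2 + s₂)) → a ≢ b → Fin r₂ → Fin (2 + s₂)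
  avoiding a b a≢b i = punchIn a (punchIn (punchOut a≢b) (inject≤ i r₂≤s₂))

  module _ {a b : Fin (2 + s₂)} (a≢b : a ≢ b) where

    avoiding≢ˡ : ∀ i → a ≢ avoiding a b a≢b i
    avoiding≢ˡ i = punchInᵢ≢i a _ ∘ sym

    avoiding≢ʳ : ∀ i → b ≢ avoiding a b a≢b i
    avoiding≢ʳ i b≡ = punchInᵢ≢i (punchOut a≢b) _
      (punchIn-injective a _ _ (trans (sym b≡) (sym (punchIn-punchOut a≢b))))

    avoiding-injective : ∀ {i j} → i ≢ j → avoiding a b a≢b i ≢ avoiding a b a≢b j
    avoiding-injective i≢j eq =
      i≢j (inject≤-injective _ _ _ _ (punchIn-injective (punchOut a≢b) _ _ (punchIn-injective a _ _ eq)))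

  -- The r - 2 new vertices of an edge uv get distinct colours other than c u and c v, which needs r ≤ s.
  extendColouring : ∀ {m} (F : Graph m) (c : Fin m → Fin (2 + s₂)) → ProperColouring F (2 + s₂) c →
                    ExpVertex (2 + r₂) F → Fin (2 + s₂)
  extendColouring F c proper (inj₁ u)                    = c u
  extendColouring F c proper (inj₂ ((u , v , uv , _) , i)) = avoiding (c u) (c v) (proper u v uv) i

  extendColouring-strong : ∀ {m} (F : Graph m) (c : Fin m → Fin (2 + s₂)) (proper : ProperColouring F (2 + s₂) c) →
                           StrongColouring (2 + r₂) F (2 + s₂) (extendColouring F c proper)
  extendColouring-strong F c proper (u , v , uv , _) =
      (cu≢cv ∷ All.tabulate⁺ (avoiding≢ˡ cu≢cv))
    ∷ All.tabulate⁺ (avoiding≢ʳ cu≢cv)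
    ∷ AllPairs.tabulate⁺ (avoiding-injective cu≢cv)
    where cu≢cv = proper u v uv

dense⇒ContainsExpansion : ∀ {r₂ s₂} → r₂ ≤ s₂ → ∀ {m} {F : Graph m} → Colourable F (2 + s₂) →
  ∀ {n k} (H : RGraph (2 + r₂) n) → blowupThreshold k (2 + s₂) (expVertexBound (2 + r₂) m) < n →
  n ^ (2 + s₂) ≤ k * numCliques (2 + s₂) H → ContainsExpansion H F
dense⇒ContainsExpansion {r₂} {s₂} r₂≤s₂ {m} {F} (c , proper) {n} {k} H large dense =
  let _ , cliques , rows = dense⇒distinct-blowup (cliqueTuple? H) large dense-tuples
  in BlowupEmbedding.blowup-contains-expansion {H = H} {F = F}
       (extendColouring-strong F c proper) (expVertexCode-injective (2 + r₂) F) cliques rows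
  where
  open ColourExtension r₂≤s₂
  open DegenerateBoxes n (expVertexBound (2 + r₂) m)
  dense-tuples = ≤-trans dense (*-monoʳ-≤ k (numCliques≤cliqueTuples (2 + s₂) H))

colourable⇒¬ExLowerΩ : ∀ {r₂ s₂} → r₂ ≤ s₂ → ∀ {m} (F : Graph m) → Colourable F (2 + s₂) → ¬ ExLowerΩ (2 + r₂) (2 + s₂) F
colourable⇒¬ExLowerΩ {r₂} {s₂} r₂≤s₂ {m} F colourable (k , N , dense) =
  let H , free , many = dense (suc (N + K)) (≤-trans (m≤m+n N K) (n≤1+n _))
  in free (dense⇒ContainsExpansion r₂≤s₂ {F = F} colourable H (s≤s (m≤n+m K N)) many)
  where K = blowupThreshold k (2 + s₂) (expVertexBound (2 + r₂) m)

-- The Turán-type construction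

module TuranConstruction (r s : ℕ) .{{_ : NonZero s}} where

  part : ∀ {n} → Fin n → Fin s
  part x = toℕ x mod s

  Rainbow : ∀ {n} → Subset n → Set
  Rainbow U = ∀ x y → x ∈ₛ U → y ∈ₛ U → part x ≡ part y → x ≡ y

  rainbow? : ∀ {n} → Decidable (Rainbow {n})
  rainbow? U = Finₚ.all? λ x → Finₚ.all? λ y → (x ∈? U) →-dec (y ∈? U) →-dec (part x ≟ part y) →-dec (x ≟ y)

  turánEdge : ∀ {n} → Subset n → Bool
  turánEdge U = (∣ U ∣ ≡ᵇ r) ∧ ⌊ rainbow? U ⌋

  T-turánEdge : ∀ {n} (U : Subset n) → T (turánEdge U) ⇔ (∣ U ∣ ≡ r × Rainbow U)
  T-turánEdge U = mk⇔ (λ h → to T-≡ᵇ (proj₁ (to ∧-split h)) , toWitness (proj₂ (to ∧-split h)))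
                      (λ (∣U∣≡r , rainbow) → from ∧-split (from T-≡ᵇ ∣U∣≡r , fromWitness rainbow))
    where ∧-split = T-∧ {∣ U ∣ ≡ᵇ r} {⌊ rainbow? U ⌋}

  turánGraph : ∀ n → RGraph r n
  turánGraph n = record { edge = turánEdge ; uniform = λ U → proj₁ ∘ to (T-turánEdge U) }

  turánGraph-free : ∀ {n m} (F : Graph m) → ¬ Colourable F s → ¬ ContainsExpansion (turánGraph n) F
  turánGraph-free F not-colourable (ι , ι-injective , ι-edge) = not-colourable (part ∘ ι ∘ inj₁ , proper)
    where
    separated : ∀ {a b} → T (adj F a b) → a Fin.< b → part (ι (inj₁ a)) ≢ part (ι (inj₁ b))
    separated {a} {b} ab a<b same = <-irrefl (inj₁-injective (ι-injective collapse)) a<b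
      where
      e = (a , b , ab , a<b)
      image = ι (inj₁ a) ∷ ι (inj₁ b) ∷ toList (tabulate (λ i → ι (inj₂ (e , i))))
      rainbow = proj₂ (to (T-turánEdge _) (ι-edge e))
      collapse = rainbow _ _ (from (∈-setOf image) (here refl)) (from (∈-setOf image) (there (here refl))) same
    proper : ProperColouring F s (part ∘ ι ∘ inj₁)
    proper u v uv with <-cmp u v
    ... | tri< u<v _ _ = separated uv u<v
    ... | tri≈ _ refl _ = ⊥-elim (subst T (irrefl F u) uv)
    ... | tri> _ _ v<u = separated (subst T (adj-sym F u v) uv) v<u ∘ sym

  module _ {n q} (qs≤n : q * s ≤ n) where

    slot : Fin s → Fin q → Fin n
    slot j y = inject≤ (combine y j) qs≤n

    part-slot : ∀ j y → part (slot j y) ≡ j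
    part-slot j y = toℕ-injective (begin
      toℕ (part (slot j y))            ≡⟨ toℕ-fromℕ< _ ⟩
      toℕ (slot j y) % s               ≡⟨ cong (_% s) (trans (toℕ-inject≤ (combine y j) qs≤n) (toℕ-combine y j)) ⟩
      (s * toℕ y + toℕ j) % s          ≡⟨ cong (_% s) (trans (+-comm (s * toℕ y) (toℕ j)) (cong (toℕ j +_) (*-comm s (toℕ y)))) ⟩
      (toℕ j + toℕ y * s) % s          ≡⟨ [m+kn]%n≡m%n (toℕ j) (toℕ y) s ⟩
      toℕ j % s                        ≡⟨ m<n⇒m%n≡m (toℕ<n j) ⟩
      toℕ j                            ∎)
      where open ≡-Reasoning

    slot-injective : ∀ {j y j′ y′} → slot j y ≡ slot j′ y′ → j ≡ j′ × y ≡ y′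
    slot-injective {j} {y} {j′} {y′} eq with combine-injective y j y′ j′ (inject≤-injective _ _ _ _ eq)
    ... | y≡y′ , j≡j′ = j≡j′ , y≡y′

    transversalSet : Vec (Fin q) s → Subset n
    transversalSet w = setOf (List.tabulate (λ j → slot j (lookup w j)))

    ∈-transversalSet⁻ : ∀ {w x} → x ∈ₛ transversalSet w → ∃ λ j → x ≡ slot j (lookup w j)
    ∈-transversalSet⁻ = ∈-tabulate⁻ ∘ to (∈-setOf _)

    transversalSet-injective : ∀ {w w′} → transversalSet w ≡ transversalSet w′ → w ≡ w′
    transversalSet-injective {w} {w′} eq = begin
      w                        ≡⟨ sym (tabulate∘lookup w) ⟩
      tabulate (lookup w)      ≡⟨ tabulate-cong same-slot ⟩
      tabulate (lookup w′)     ≡⟨ tabulate∘lookup w′ ⟩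
      w′                       ∎
      where
      open ≡-Reasoning
      same-slot : ∀ j → lookup w j ≡ lookup w′ j
      same-slot j with ∈-transversalSet⁻ {w′} (subst (slot j (lookup w j) ∈ₛ_) eq (from (∈-setOf _) (∈-tabulate⁺ j)))
      ... | j′ , slot≡ with slot-injective slot≡
      ...   | refl , w≡w′ = w≡w′

    transversalSet-clique : ∀ w → T ((∣ transversalSet w ∣ ≡ᵇ s) ∧ spansClique (turánGraph n) (transversalSet w))
    transversalSet-clique w = from T-∧ (from T-≡ᵇ size , from (T-spansClique {H = turánGraph n}) edges)
      where
      slots-unique = Unique.tabulate⁺ (proj₁ ∘ slot-injective)
      size : ∣ transversalSet w ∣ ≡ s
      size = trans (∣setOf∣≡length slots-unique) (length-tabulate _)
      rainbow : ∀ U → U ⊆ₛ transversalSet w → Rainbow U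
      rainbow U U⊆ x y x∈ y∈ same with ∈-transversalSet⁻ {w} (U⊆ x∈) | ∈-transversalSet⁻ {w} (U⊆ y∈)
      ... | j , refl | j′ , refl = cong (λ j → slot j (lookup w j)) (trans (sym (part-slot j _)) (trans same (part-slot j′ _)))
      edges : ∀ U → U ⊆ₛ transversalSet w → ∣ U ∣ ≡ r → T (turánEdge U)
      edges U U⊆ ∣U∣≡r = from (T-turánEdge U) (∣U∣≡r , rainbow U U⊆)

    turánGraph-cliques : q ^ s ≤ numCliques s (turánGraph n)
    turánGraph-cliques = begin
      q ^ s                                   ≡⟨ sym (trans (length-map transversalSet (vecs (allFin q) s))
                                                       (trans (length-vecs (allFin q) s) (cong (_^ s) (length-tabulate _)))) ⟩
      length (map transversalSet (vecs (allFin q) s))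
        ≤⟨ Unique-⊆⇒length≤ (Unique.map⁺ transversalSet-injective (vecs-unique (Unique.allFin⁺ q) s)) cliques ⟩
      numCliques s (turánGraph n)            ∎
      where
      open ≤-Reasoning
      cliques : map transversalSet (vecs (allFin q) s) ⊆ filter _ (allSubsets n)
      cliques S∈ with ∈-map⁻ transversalSet S∈
      ... | w , _ , refl = ∈-filter⁺ _ (∈-allSubsets (transversalSet w)) (transversalSet-clique w)

ExUpperO-holds : ∀ r s {m} (F : Graph m) → ExUpperO r s F
ExUpperO-holds r s F = 1 , 0 , λ n _ H _ → begin
  numCliques s H                   ≤⟨ numCliques≤cliqueTuples s H ⟩
  cliqueTuples s H                 ≤⟨ ∑-𝟙≤length (vecs (allFin n) s) _ ⟩
  length (vecs (allFin n) s)       ≡⟨ trans (length-vecs (allFin n) s) (cong (_^ s) (length-tabulate id)) ⟩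
  n ^ s                            ≡⟨ sym (*-identityˡ (n ^ s)) ⟩
  1 * n ^ s                        ∎
  where open ≤-Reasoning

¬Colourable⇒ExLowerΩ : ∀ r s .{{_ : NonZero s}} {m} (F : Graph m) → ¬ Colourable F s → ExLowerΩ r s F
¬Colourable⇒ExLowerΩ r s F not-colourable = (2 * s) ^ s , s , λ n s≤n →
  turánGraph n , turánGraph-free F not-colourable , cliques n s≤n
  where
  open TuranConstruction r s
  cliques : ∀ n → s ≤ n → n ^ s ≤ (2 * s) ^ s * numCliques s (turánGraph n)
  cliques n s≤n = begin
    n ^ s                              ≤⟨ ^-monoˡ-≤ s n≤2sq ⟩
    (2 * s * q) ^ s                    ≡⟨ ^-distribʳ-* (2 * s) q s ⟩
    (2 * s) ^ s * q ^ s                ≤⟨ *-monoʳ-≤ ((2 * s) ^ s) (turánGraph-cliques (m/n*n≤m n s)) ⟩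
    (2 * s) ^ s * numCliques s (turánGraph n) ∎
    where
    open ≤-Reasoning
    q = n / s
    instance
      q≢0 : NonZero q
      q≢0 = >-nonZero (m≥n⇒m/n>0 s≤n)
    n≤2sq : n ≤ 2 * s * q
    n≤2sq = begin
      n                  ≡⟨ m≡m%n+[m/n]*n n s ⟩
      n % s + q * s      ≤⟨ +-monoˡ-≤ (q * s) (≤-trans (<⇒≤ (m%n<n n s)) (m≤m*n s q)) ⟩
      s * q + q * s      ≡⟨ double s q ⟩
      2 * s * q          ∎
      where
      double : ∀ s q → s * q + q * s ≡ 2 * s * q
      double = solve-∀

proposition2p1 : (r s : ℕ) → 2 ≤ r → r ≤ s → (m : ℕ) → (F : Graph m) →
    ExTheta r s F ⇔ ChromaticNumberExceeds F s
proposition2p1 r s@(suc _) (s≤s (s≤s z≤n)) (s≤s (s≤s r₂≤s₂)) m F = mk⇔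
  (λ (_ , dense) colourable → colourable⇒¬ExLowerΩ r₂≤s₂ F colourable dense)
  (λ not-colourable → ExUpperO-holds r s F , ¬Colourable⇒ExLowerΩ r s F not-colourable)
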